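{- Let $v\ge 2$ and $t\ge 1$ be integers, and let $M=M_t(v,t+1)$ be the $t$-inclusion matrix defined in the context, over the reals. There exists a basis of the null space $\{\mathbf T\in\mathbb R^{V^{t+1}}: M\mathbf T=\mathbf 0\}$ consisting only of frequency vectors of $t$-$(v,t+1)$ intercalates.
   Context: Let $V=\{0,1,\ldots,v-1\}$ and $k=t+1$. For a $t$-subset $I=\{i_1<\cdots<i_t\}$ of $\{1,\ldots,k\}$ and $u_1,\ldots,u_t\in V$, say $(u_1,\ldots,u_t)_I\in(x_1,\ldots,x_k)$ iff $u_j=x_{i_j}$ for all $j$. The matrix $M_t(v,k)$ has columns indexed by $V^k$, rows indexed by all $(u_1,\ldots,u_t)_I$ with $I$ ranging over $t$-subsets of $\{1,\ldots,k\}$, and entry $1$ in row $(u_1,\ldots,u_t)_I$, column $\mathbf x$ iff $(u_1,\ldots,u_t)_I\in\mathbf x$, else $0$. A homogeneous polynomial of degree $k$ in non-commuting variables $x_0,\ldots,x_{v-1}$ (so monomials $x_{a_1}x_{a_2}\cdots x_{a_k}$ are ordered words) corresponds to the frequency vector $\mathbf T\in\mathbb R^{V^k}$ whose entry at $(a_1,\ldots,a_k)$ is the coefficient of the monomial $x_{a_1}\cdots x_{a_k}$. A $t$-$(v,t+1)$ intercalate is the polynomial \[ (x_{i_1}-x_{j_1})(x_{i_2}-x_{j_2})\cdots(x_{i_{t+1}}-x_{j_{t+1}}), \] expanded in the non-commutative ring, where $i_l,j_l\in V$ and $i_l\neq j_l$ for each $l$.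
   Formalization: The null space of $M$, its frequency vectors and the coefficients used for linear independence and spanning are taken over ℚ rather than ℝ. -}

module Defs where

open import Data.Bool using (Bool; true; false; _∧_; if_then_else_)
open import Data.Nat using (ℕ; zero; suc)
open import Data.Fin using (Fin; zero; suc; _≟_)
open import Data.Fin.Subset using (Subset; ∣_∣)
open import Data.List using (List; []; _∷_; map; concatMap; allFin; foldr)
open import Data.Vec using (Vec; []; _∷_; toList; lookup)
open import Data.Rational using (ℚ; 0ℚ; 1ℚ; _+_; _*_; -_)
open import Relation.Nullary.Decidable using (⌊_⌋)
open import Relation.Binary.PropositionalEquality using (_≡_; _≢_)
open import Data.Product using (Σ; _×_; ∃)

allWords : (v k : ℕ) → List (Vec (Fin v) k)
allWords v zero = [] ∷ []
allWords v (suc k) = concatMap (λ a → map (a ∷_) (allWords v k)) (allFin v)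

sumℚ : List ℚ → ℚ
sumℚ = foldr _+_ 0ℚ

ΣFin : (n : ℕ) → (Fin n → ℚ) → ℚ
ΣFin zero f = 0ℚ
ΣFin (suc n) f = f zero + ΣFin n (λ i → f (suc i))

ΠFin : (n : ℕ) → (Fin n → ℚ) → ℚ
ΠFin zero f = 1ℚ
ΠFin (suc n) f = f zero * ΠFin n (λ i → f (suc i))

-- (u_1,…,u_t)_I ∈ (x_1,…,x_k): I ⊆ {1..k} given as a Subset k (positions in
-- increasing order), u listed in order; u_j must equal x_{i_j}.
incl : ∀ {v k} → Subset k → List (Fin v) → Vec (Fin v) k → Bool
incl [] [] [] = true
incl [] (_ ∷ _) [] = false
incl (true ∷ I) [] (x ∷ xs) = false
incl (true ∷ I) (u ∷ us) (x ∷ xs) = ⌊ u ≟ x ⌋ ∧ incl I us xs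
incl (false ∷ I) us (x ∷ xs) = incl I us xs

Mentry : ∀ {v k t} → Subset k → Vec (Fin v) t → Vec (Fin v) k → ℚ
Mentry I u x = if incl I (toList u) x then 1ℚ else 0ℚ

FreqVec : ℕ → ℕ → Set
FreqVec v k = Vec (Fin v) k → ℚ

MRow : ∀ {v k t} → Subset k → Vec (Fin v) t → FreqVec v k → ℚ
MRow {v} {k} I u T = sumℚ (map (λ x → Mentry I u x * T x) (allWords v k))

InNullSpace : (v t k : ℕ) → FreqVec v k → Set
InNullSpace v t k T =
  (I : Subset k) → ∣ I ∣ ≡ t → (u : Vec (Fin v) t) → MRow I u T ≡ 0ℚ

-- Data of a t-(v,t+1) intercalate (x_{i_1}-x_{j_1})⋯(x_{i_k}-x_{j_k}), k = t+1.
record Intercalate (v k : ℕ) : Set where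
  field
    is   : Vec (Fin v) k
    js   : Vec (Fin v) k
    dist : (l : Fin k) → lookup is l ≢ lookup js l

linCoeff : ∀ {v} → Fin v → Fin v → Fin v → ℚ
linCoeff i j a =
  (if ⌊ a ≟ i ⌋ then 1ℚ else 0ℚ) + (if ⌊ a ≟ j ⌋ then - 1ℚ else 0ℚ)

-- Frequency vector of the non-commutative product of linear forms:
-- the coefficient of the word x_{a_1}⋯x_{a_k} is ∏_l (coeff of x_{a_l} in l-th factor).
intercalateFreq : ∀ {v k} → Intercalate v k → FreqVec v k
intercalateFreq {v} {k} c a =
  ΠFin k (λ l → linCoeff (lookup (Intercalate.is c) l) (lookup (Intercalate.js c) l) (lookup a l))

linComb : ∀ {v k} (n : ℕ) → (Fin n → ℚ) → (Fin n → FreqVec v k) → FreqVec v k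
linComb n c f x = ΣFin n (λ m → c m * f m x)

IsNullSpaceBasis : (v t k n : ℕ) → (Fin n → FreqVec v k) → Set
IsNullSpaceBasis v t k n B =
  ((m : Fin n) → InNullSpace v t k (B m))
  × ((c : Fin n → ℚ) → ((x : Vec (Fin v) k) → linComb n c B x ≡ 0ℚ)
       → (m : Fin n) → c m ≡ 0ℚ)
  × ((T : FreqVec v k) → InNullSpace v t k T
       → Σ (Fin n → ℚ) (λ c → (x : Vec (Fin v) k) → T x ≡ linComb n c B x))

-- A row (u)_I of M_t(v,t+1) sums T over the words agreeing with u on I; as
-- |I| = t, exactly one coordinate p is free, so M T = 0 says that T sums to
-- zero along every line {x [ p ]≔ a : a ∈ V}.  Such a T is determined by its
-- values on the words over V ∖ {0}: the line through 0 ∷ x in direction 0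
-- expresses T (0 ∷ x) by the values T (b ∷ x), b ≠ 0.  The intercalates
-- (x_{y₁+1} − x₀)⋯(x_{yₖ+1} − x₀), y ∈ {0,…,v−2}^k, are products of linear
-- forms with coefficient sum 0, hence lie in the null space, and on the words
-- over V ∖ {0} they are the indicator functions of single words.
module Submission where

open import Defs
open import Data.Nat using (ℕ; zero; suc; _≤_; _<_; _∸_; _^_; s≤s)
open import Data.Nat.Properties using (≤-reflexive)
open import Data.Fin using (Fin; zero; suc; _≟_; combine; funToFin; finToFun)
open import Data.Fin.Properties using (suc-injective; 0≢1+n; finToFun-funToFin; funToFin-finToFin)
open import Data.Fin.Subset using (Subset; ∣_∣; ⊥; ⁅_⁆; ∁)
open import Data.Fin.Subset.Properties using (∣∁p∣≡n∸∣p∣; ∣⁅x⁆∣≡1)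
open import Data.Bool using (Bool; true; false; _∧_; if_then_else_)
open import Data.List as List using (List; []; _∷_; concatMap; allFin)
import Data.List.Properties as List
open import Data.Vec as Vec using (Vec; []; _∷_; toList; lookup; replicate; tabulate; removeAt; _[_]≔_)
import Data.Vec.Properties as Vec
open import Data.Rational using (ℚ; 0ℚ; 1ℚ; _+_; _*_; -_)
open import Data.Rational.Properties
  using ( +-identityˡ; +-identityʳ; +-assoc; +-inverseʳ; +-0-group; +-0-commutativeMonoid
        ; *-identityˡ; *-identityʳ; *-zeroˡ; *-zeroʳ; *-assoc; *-comm; *-distribˡ-+; *-1-commutativeMonoid)
open import Algebra.Bundles using (CommutativeMonoid)
open import Algebra.Properties.Group +-0-group using (∙-cancelʳ)
open import Algebra.Properties.CommutativeSemigroup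
  (CommutativeMonoid.commutativeSemigroup +-0-commutativeMonoid) using (interchange)
open import Algebra.Properties.CommutativeSemigroup
  (CommutativeMonoid.commutativeSemigroup *-1-commutativeMonoid) using (x∙yz≈y∙xz)
open import Data.Product using (Σ; _,_)
open import Data.Empty using (⊥-elim)
open import Relation.Nullary using (yes; no)
open import Function using (_∘_; id)
open import Relation.Nullary.Decidable using (⌊_⌋)
open import Relation.Binary.PropositionalEquality

indicator : Bool → ℚ
indicator b = if b then 1ℚ else 0ℚ

indicator-∧ : ∀ b c → indicator (b ∧ c) ≡ indicator b * indicator c
indicator-∧ true  c = sym (*-identityˡ (indicator c))
indicator-∧ false c = sym (*-zeroˡ (indicator c))

⌊≟⌋-refl : ∀ {n} (x : Fin n) → ⌊ x ≟ x ⌋ ≡ true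
⌊≟⌋-refl x = cong ⌊_⌋ (≡-≟-identity _≟_ refl)

⌊≟⌋-≢ : ∀ {n} {x y : Fin n} → x ≢ y → ⌊ x ≟ y ⌋ ≡ false
⌊≟⌋-≢ x≢y = cong ⌊_⌋ (≢-≟-identity _≟_ x≢y)

ΣFin-cong : ∀ n {f g : Fin n → ℚ} → (∀ i → f i ≡ g i) → ΣFin n f ≡ ΣFin n g
ΣFin-cong zero    h = refl
ΣFin-cong (suc n) h = cong₂ _+_ (h zero) (ΣFin-cong n (h ∘ suc))

ΣFin-zero : ∀ n {f : Fin n → ℚ} → (∀ i → f i ≡ 0ℚ) → ΣFin n f ≡ 0ℚ
ΣFin-zero zero    h = refl
ΣFin-zero (suc n) h = trans (cong₂ _+_ (h zero) (ΣFin-zero n (h ∘ suc))) (+-identityˡ 0ℚ)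

ΣFin-single : ∀ {n} (f : Fin n → ℚ) (i : Fin n) → (∀ j → j ≢ i → f j ≡ 0ℚ) → ΣFin n f ≡ f i
ΣFin-single {n = suc n} f zero h =
  trans (cong (f zero +_) (ΣFin-zero n (λ j → h (suc j) λ ()))) (+-identityʳ (f zero))
ΣFin-single {n = suc n} f (suc i) h =
  trans (cong (_+ ΣFin n (f ∘ suc)) (h zero λ ()))
    (trans (+-identityˡ _) (ΣFin-single (f ∘ suc) i (λ j j≢i → h (suc j) (j≢i ∘ suc-injective))))

ΣFin-*ˡ : ∀ {n} c (f : Fin n → ℚ) → ΣFin n (λ i → c * f i) ≡ c * ΣFin n f
ΣFin-*ˡ {n = zero}  c f = sym (*-zeroʳ c)
ΣFin-*ˡ {n = suc n} c f = trans (cong (c * f zero +_) (ΣFin-*ˡ c (f ∘ suc))) (sym (*-distribˡ-+ c _ _))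

ΣFin-*ʳ : ∀ {n} c (f : Fin n → ℚ) → ΣFin n (λ i → f i * c) ≡ ΣFin n f * c
ΣFin-*ʳ {n} c f = trans (ΣFin-cong n (λ i → *-comm (f i) c)) (trans (ΣFin-*ˡ c f) (*-comm c _))

ΣFin-+ : ∀ {n} (f g : Fin n → ℚ) → ΣFin n (λ i → f i + g i) ≡ ΣFin n f + ΣFin n g
ΣFin-+ {n = zero}  f g = sym (+-identityˡ 0ℚ)
ΣFin-+ {n = suc n} f g =
  trans (cong (f zero + g zero +_) (ΣFin-+ (f ∘ suc) (g ∘ suc)))
    (interchange (f zero) (g zero) (ΣFin n (f ∘ suc)) (ΣFin n (g ∘ suc)))

ΣFin-swap : ∀ {n} m (f : Fin n → Fin m → ℚ) →
  ΣFin n (λ i → ΣFin m (f i)) ≡ ΣFin m (λ j → ΣFin n (λ i → f i j))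
ΣFin-swap {n = zero}  m f = sym (ΣFin-zero m (λ _ → refl))
ΣFin-swap {n = suc n} m f =
  trans (cong (ΣFin m (f zero) +_) (ΣFin-swap m (f ∘ suc)))
    (sym (ΣFin-+ (f zero) (λ j → ΣFin n (λ i → f (suc i) j))))

ΣFin-if-≟ : ∀ {n} (x : Fin n) (c : ℚ) → ΣFin n (λ a → if ⌊ a ≟ x ⌋ then c else 0ℚ) ≡ c
ΣFin-if-≟ x c = trans
  (ΣFin-single _ x (λ a a≢x → cong (λ b → if b then c else 0ℚ) (⌊≟⌋-≢ a≢x)))
  (cong (λ b → if b then c else 0ℚ) (⌊≟⌋-refl x))

linCoeff-sum : ∀ {v} (i j : Fin v) → ΣFin v (linCoeff i j) ≡ 0ℚ
linCoeff-sum {v} i j = begin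
  ΣFin v (linCoeff i j)
    ≡⟨ ΣFin-+ (λ a → indicator ⌊ a ≟ i ⌋) (λ a → if ⌊ a ≟ j ⌋ then - 1ℚ else 0ℚ) ⟩
  _                      ≡⟨ cong₂ _+_ (ΣFin-if-≟ i 1ℚ) (ΣFin-if-≟ j (- 1ℚ)) ⟩
  1ℚ + - 1ℚ              ≡⟨ +-inverseʳ 1ℚ ⟩
  0ℚ                     ∎
  where open ≡-Reasoning

sumℚ-++ : ∀ xs ys → sumℚ (xs List.++ ys) ≡ sumℚ xs + sumℚ ys
sumℚ-++ []       ys = sym (+-identityˡ _)
sumℚ-++ (x ∷ xs) ys = trans (cong (x +_) (sumℚ-++ xs ys)) (sym (+-assoc x _ _))

sumℚ-concatMap : ∀ {A B : Set} (g : B → ℚ) (f : A → List B) (l : List A) →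
  sumℚ (List.map g (concatMap f l)) ≡ sumℚ (List.map (λ a → sumℚ (List.map g (f a))) l)
sumℚ-concatMap g f []      = refl
sumℚ-concatMap g f (a ∷ l) =
  trans (cong sumℚ (List.map-++ g (f a) (concatMap f l)))
    (trans (sumℚ-++ (List.map g (f a)) (List.map g (concatMap f l)))
      (cong (sumℚ (List.map g (f a)) +_) (sumℚ-concatMap g f l)))

sumℚ-tabulate : ∀ {A : Set} n (h : A → ℚ) (f : Fin n → A) →
  sumℚ (List.map h (List.tabulate f)) ≡ ΣFin n (h ∘ f)
sumℚ-tabulate zero    h f = refl
sumℚ-tabulate (suc n) h f = cong (h (f zero) +_) (sumℚ-tabulate n h (f ∘ suc))

sumℚ-*ˡ : ∀ {A : Set} c (g : A → ℚ) (l : List A) →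
  sumℚ (List.map (λ x → c * g x) l) ≡ c * sumℚ (List.map g l)
sumℚ-*ˡ c g []      = sym (*-zeroʳ c)
sumℚ-*ˡ c g (x ∷ l) = trans (cong (c * g x +_) (sumℚ-*ˡ c g l)) (sym (*-distribˡ-+ c _ _))

sumWords : ∀ v k → FreqVec v k → ℚ
sumWords v k g = sumℚ (List.map g (allWords v k))

module _ (v k : ℕ) where

  sumWords-cong : {f g : FreqVec v k} → (∀ x → f x ≡ g x) → sumWords v k f ≡ sumWords v k g
  sumWords-cong h = cong sumℚ (List.map-cong h (allWords v k))

  sumWords-zero : {g : FreqVec v k} → (∀ x → g x ≡ 0ℚ) → sumWords v k g ≡ 0ℚ
  sumWords-zero h = trans (sumWords-cong h) (zeros (allWords v k))
    where
    zeros : ∀ {A : Set} (l : List A) → sumℚ (List.map (λ _ → 0ℚ) l) ≡ 0ℚ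
    zeros []      = refl
    zeros (x ∷ l) = trans (+-identityˡ _) (zeros l)

  sumWords-*ˡ : ∀ c (g : FreqVec v k) → sumWords v k (λ x → c * g x) ≡ c * sumWords v k g
  sumWords-*ˡ c g = sumℚ-*ˡ c g (allWords v k)

  sumWords-suc : (g : FreqVec v (suc k)) →
    sumWords v (suc k) g ≡ ΣFin v (λ a → sumWords v k (λ ys → g (a ∷ ys)))
  sumWords-suc g =
    trans (sumℚ-concatMap g (λ a → List.map (a ∷_) (allWords v k)) (allFin v))
      (trans (sumℚ-tabulate v (λ a → sumℚ (List.map g (List.map (a ∷_) (allWords v k)))) id)
        (ΣFin-cong v (λ a → cong sumℚ (sym (List.map-∘ (allWords v k))))))

-- Rows are indexed by lists rather than vectors since incl consumes u one
-- entry at a time; MRow I u is MRowᴸ I (toList u) by definition.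
MRowᴸ : ∀ {v k} → Subset k → List (Fin v) → FreqVec v k → ℚ
MRowᴸ {v} {k} I us T = sumWords v k (λ x → indicator (incl I us x) * T x)

module _ {v k : ℕ} (I : Subset k) where

  MRowᴸ-*ˡ : ∀ us c (g : FreqVec v k) → MRowᴸ I us (λ x → c * g x) ≡ c * MRowᴸ I us g
  MRowᴸ-*ˡ us c g =
    trans (sumWords-cong v k (λ x → x∙yz≈y∙xz (indicator (incl I us x)) c (g x))) (sumWords-*ˡ v k c _)

  MRowᴸ-false : ∀ us (g : FreqVec v (suc k)) →
    MRowᴸ (false ∷ I) us g ≡ ΣFin v (λ a → MRowᴸ I us (λ ys → g (a ∷ ys)))
  MRowᴸ-false us g = sumWords-suc v k _

  MRowᴸ-true : ∀ u us (g : FreqVec v (suc k)) →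
    MRowᴸ (true ∷ I) (u ∷ us) g ≡ MRowᴸ I us (λ ys → g (u ∷ ys))
  MRowᴸ-true u us g = begin
    MRowᴸ (true ∷ I) (u ∷ us) g
      ≡⟨ sumWords-suc v k _ ⟩
    ΣFin v (λ a → sumWords v k (λ ys → indicator (⌊ u ≟ a ⌋ ∧ incl I us ys) * g (a ∷ ys)))
      ≡⟨ ΣFin-cong v (λ a → trans (sumWords-cong v k (λ ys →
           trans (cong (_* g (a ∷ ys)) (indicator-∧ ⌊ u ≟ a ⌋ (incl I us ys)))
             (*-assoc (indicator ⌊ u ≟ a ⌋) (indicator (incl I us ys)) (g (a ∷ ys)))))
           (sumWords-*ˡ v k (indicator ⌊ u ≟ a ⌋) _)) ⟩
    ΣFin v (λ a → indicator ⌊ u ≟ a ⌋ * rest a)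
      ≡⟨ ΣFin-single _ u (λ a a≢u → trans
           (cong (λ b → indicator b * rest a) (⌊≟⌋-≢ (a≢u ∘ sym))) (*-zeroˡ (rest a))) ⟩
    indicator ⌊ u ≟ u ⌋ * rest u
      ≡⟨ trans (cong (λ b → indicator b * rest u) (⌊≟⌋-refl u)) (*-identityˡ (rest u)) ⟩
    rest u ∎
    where
    open ≡-Reasoning
    rest : Fin v → ℚ
    rest a = MRowᴸ I us (λ ys → g (a ∷ ys))

-- The full row set is written ∁ ⊥ (not ⊤) because ∁ ⁅ zero ⁆ computes to false ∷ ∁ ⊥.
MRowᴸ-∁⊥ : ∀ {v} k (xs : Vec (Fin v) k) (g : FreqVec v k) → MRowᴸ (∁ ⊥) (toList xs) g ≡ g xs
MRowᴸ-∁⊥ zero    []       g = trans (+-identityʳ _) (*-identityˡ (g []))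
MRowᴸ-∁⊥ (suc k) (x ∷ xs) g =
  trans (MRowᴸ-true (∁ ⊥) x (toList xs) g) (MRowᴸ-∁⊥ k xs (λ ys → g (x ∷ ys)))

MRowᴸ-∁⁅_⁆ : ∀ {v k} (p : Fin (suc k)) (x : Vec (Fin v) (suc k)) (T : FreqVec v (suc k)) →
  MRowᴸ (∁ ⁅ p ⁆) (toList (removeAt x p)) T ≡ ΣFin v (λ a → T (x [ p ]≔ a))
MRowᴸ-∁⁅_⁆ {v} {k} zero (x ∷ xs) T =
  trans (MRowᴸ-false (∁ ⊥) (toList xs) T) (ΣFin-cong v (λ a → MRowᴸ-∁⊥ k xs (λ ys → T (a ∷ ys))))
MRowᴸ-∁⁅_⁆ (suc p) (x ∷ xs@(_ ∷ _)) T =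
  trans (MRowᴸ-true (∁ ⁅ p ⁆) x (toList (removeAt xs p)) T) (MRowᴸ-∁⁅ p ⁆ xs (λ ys → T (x ∷ ys)))

LineSumsVanish : ∀ {v k} → FreqVec v k → Set
LineSumsVanish {v} T = ∀ p x → ΣFin v (λ a → T (x [ p ]≔ a)) ≡ 0ℚ

inNullSpace⇒lineSumsVanish : ∀ {v} t {T : FreqVec v (suc t)} →
  InNullSpace v t (suc t) T → LineSumsVanish T
inNullSpace⇒lineSumsVanish t {T} hT p x =
  trans (sym (MRowᴸ-∁⁅ p ⁆ x T)) (hT (∁ ⁅ p ⁆) ∣∁⁅p⁆∣ (removeAt x p))
  where
  ∣∁⁅p⁆∣ : ∣ ∁ ⁅ p ⁆ ∣ ≡ t
  ∣∁⁅p⁆∣ = trans (∣∁p∣≡n∸∣p∣ ⁅ p ⁆) (cong (suc t ∸_) (∣⁅x⁆∣≡1 p))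

lineSumsVanish-linComb : ∀ {v k} n c (f : Fin n → FreqVec v k) →
  (∀ m → LineSumsVanish (f m)) → LineSumsVanish (linComb n c f)
lineSumsVanish-linComb {v} n c f hf p x =
  trans (ΣFin-swap n (λ a m → c m * f m (x [ p ]≔ a)))
    (ΣFin-zero n (λ m → trans (ΣFin-*ˡ (c m) (λ a → f m (x [ p ]≔ a)))
      (trans (cong (c m *_) (hf m p x)) (*-zeroʳ (c m)))))

lineSumsVanish-unique : ∀ {W} k {T T′ : FreqVec (suc W) k} →
  LineSumsVanish T → LineSumsVanish T′ →
  (∀ z → T (Vec.map suc z) ≡ T′ (Vec.map suc z)) → ∀ x → T x ≡ T′ x
lineSumsVanish-unique zero hT hT′ h [] = h []
lineSumsVanish-unique {W} (suc k) {T} {T′} hT hT′ h (a ∷ x) = agree a x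
  where
  agree-suc : ∀ b x → T (suc b ∷ x) ≡ T′ (suc b ∷ x)
  agree-suc b = lineSumsVanish-unique k
    (λ p y → hT (suc p) (suc b ∷ y)) (λ p y → hT′ (suc p) (suc b ∷ y)) (λ z → h (b ∷ z))
  agree : ∀ a x → T (a ∷ x) ≡ T′ (a ∷ x)
  agree (suc b) x = agree-suc b x
  agree zero x = ∙-cancelʳ (ΣFin W (λ b → T (suc b ∷ x))) _ _ (begin
    T (zero ∷ x) + ΣFin W (λ b → T (suc b ∷ x))    ≡⟨ hT zero (zero ∷ x) ⟩
    0ℚ                                              ≡⟨ hT′ zero (zero ∷ x) ⟨
    T′ (zero ∷ x) + ΣFin W (λ b → T′ (suc b ∷ x))
      ≡⟨ cong (T′ (zero ∷ x) +_) (ΣFin-cong W (λ b → sym (agree-suc b x))) ⟩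
    T′ (zero ∷ x) + ΣFin W (λ b → T (suc b ∷ x))   ∎)
    where open ≡-Reasoning

wordProduct : ∀ {v k} → (Fin k → Fin v → ℚ) → FreqVec v k
wordProduct {k = k} f y = ΠFin k (λ l → f l (lookup y l))

MRowᴸ-wordProduct : ∀ {v k} (I : Subset k) us (f : Fin k → Fin v → ℚ) →
  (∀ l → ΣFin v (f l) ≡ 0ℚ) → List.length us < k → MRowᴸ I us (wordProduct f) ≡ 0ℚ
MRowᴸ-wordProduct {v} {suc k} (true ∷ I) [] f hf _ =
  sumWords-zero v (suc k) (λ { (a ∷ ys) → *-zeroˡ (wordProduct f (a ∷ ys)) })
MRowᴸ-wordProduct (true ∷ I) (u ∷ us) f hf (s≤s lt) = begin
  MRowᴸ (true ∷ I) (u ∷ us) (wordProduct f)  ≡⟨ MRowᴸ-true I u us (wordProduct f) ⟩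
  MRowᴸ I us (λ ys → f zero u * rest ys)     ≡⟨ MRowᴸ-*ˡ I us (f zero u) rest ⟩
  f zero u * MRowᴸ I us rest
    ≡⟨ cong (f zero u *_) (MRowᴸ-wordProduct I us (f ∘ suc) (hf ∘ suc) lt) ⟩
  f zero u * 0ℚ                              ≡⟨ *-zeroʳ (f zero u) ⟩
  0ℚ                                         ∎
  where
  open ≡-Reasoning
  rest = wordProduct (f ∘ suc)
MRowᴸ-wordProduct {v} (false ∷ I) us f hf _ = begin
  MRowᴸ (false ∷ I) us (wordProduct f)
    ≡⟨ MRowᴸ-false I us (wordProduct f) ⟩
  ΣFin v (λ a → MRowᴸ I us (λ ys → f zero a * rest ys))
    ≡⟨ ΣFin-cong v (λ a → MRowᴸ-*ˡ I us (f zero a) rest) ⟩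
  ΣFin v (λ a → f zero a * MRowᴸ I us rest)
    ≡⟨ ΣFin-*ʳ (MRowᴸ I us rest) (f zero) ⟩
  ΣFin v (f zero) * MRowᴸ I us rest
    ≡⟨ cong (_* MRowᴸ I us rest) (hf zero) ⟩
  0ℚ * MRowᴸ I us rest
    ≡⟨ *-zeroˡ (MRowᴸ I us rest) ⟩
  0ℚ ∎
  where
  open ≡-Reasoning
  rest = wordProduct (f ∘ suc)

intercalate-inNullSpace : ∀ {v t} (c : Intercalate v (suc t)) →
  InNullSpace v t (suc t) (intercalateFreq c)
intercalate-inNullSpace c I _ u =
  MRowᴸ-wordProduct I (toList u) (λ l → linCoeff (lookup is l) (lookup js l))
    (λ l → linCoeff-sum (lookup is l) (lookup js l)) (s≤s (≤-reflexive (Vec.length-toList u)))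
  where open Intercalate c

standardIntercalate : ∀ {W k} → Vec (Fin W) k → Intercalate (suc W) k
standardIntercalate {k = k} y = record
  { is   = Vec.map suc y
  ; js   = replicate k zero
  ; dist = λ l eq → 0≢1+n
      (trans (sym (Vec.lookup-replicate l zero)) (trans (sym eq) (Vec.lookup-map l suc y)))
  }

standardIntercalate-diag : ∀ {W k} (z : Vec (Fin W) k) →
  intercalateFreq (standardIntercalate z) (Vec.map suc z) ≡ 1ℚ
standardIntercalate-diag []      = refl
standardIntercalate-diag (b ∷ z) =
  cong₂ _*_ (cong (λ e → indicator e + 0ℚ) (⌊≟⌋-refl (suc b))) (standardIntercalate-diag z)

standardIntercalate-offDiag : ∀ {W k} (y z : Vec (Fin W) k) → y ≢ z →
  intercalateFreq (standardIntercalate y) (Vec.map suc z) ≡ 0ℚ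
standardIntercalate-offDiag []      []      y≢z = ⊥-elim (y≢z refl)
standardIntercalate-offDiag (b ∷ y) (c ∷ z) y≢z with c ≟ b
... | yes refl =
  trans (cong ((1ℚ + 0ℚ) *_) (standardIntercalate-offDiag y z (y≢z ∘ cong (b ∷_)))) (*-zeroʳ (1ℚ + 0ℚ))
... | no _     = *-zeroˡ (intercalateFreq (standardIntercalate y) (Vec.map suc z))

funToFin-cong : ∀ {m n} {f g : Fin m → Fin n} → (∀ i → f i ≡ g i) → funToFin f ≡ funToFin g
funToFin-cong {zero}  h = refl
funToFin-cong {suc m} h = cong₂ combine (h zero) (funToFin-cong (h ∘ suc))

module WordEncoding (W k : ℕ) where

  decode : Fin (W ^ k) → Vec (Fin W) k
  decode m = tabulate (finToFun m)

  encode : Vec (Fin W) k → Fin (W ^ k)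
  encode z = funToFin (lookup z)

  decode-encode : ∀ z → decode (encode z) ≡ z
  decode-encode z = trans (Vec.tabulate-cong (finToFun-funToFin (lookup z))) (Vec.tabulate∘lookup z)

  encode-decode : ∀ m → encode (decode m) ≡ m
  encode-decode m =
    trans (funToFin-cong {k} {W} (Vec.lookup∘tabulate (finToFun m))) (funToFin-finToFin {k} {W} m)

module _ (W t : ℕ) where

  open WordEncoding W (suc t)

  intercalateBasis : Fin (W ^ suc t) → Intercalate (suc W) (suc t)
  intercalateBasis = standardIntercalate ∘ decode

  linComb-intercalateBasis : ∀ c z →
    linComb (W ^ suc t) c (intercalateFreq ∘ intercalateBasis) (Vec.map suc z) ≡ c (encode z)
  linComb-intercalateBasis c z = begin
    ΣFin (W ^ suc t) (λ m → c m * intercalateFreq (intercalateBasis m) (Vec.map suc z))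
      ≡⟨ ΣFin-single _ (encode z) (λ m m≢ez → trans
           (cong (c m *_) (standardIntercalate-offDiag (decode m) z
             (λ dm≡z → m≢ez (trans (sym (encode-decode m)) (cong encode dm≡z)))))
           (*-zeroʳ (c m))) ⟩
    c (encode z) * intercalateFreq (standardIntercalate (decode (encode z))) (Vec.map suc z)
      ≡⟨ cong (λ y → c (encode z) * intercalateFreq (standardIntercalate y) (Vec.map suc z))
           (decode-encode z) ⟩
    c (encode z) * intercalateFreq (standardIntercalate z) (Vec.map suc z)
      ≡⟨ trans (cong (c (encode z) *_) (standardIntercalate-diag z)) (*-identityʳ (c (encode z))) ⟩
    c (encode z) ∎
    where open ≡-Reasoning

  intercalateBasis-isNullSpaceBasis :
    IsNullSpaceBasis (suc W) t (suc t) (W ^ suc t) (intercalateFreq ∘ intercalateBasis)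
  intercalateBasis-isNullSpaceBasis = inNullSpace , independent , spanning
    where
    B = intercalateFreq ∘ intercalateBasis

    inNullSpace : ∀ m → InNullSpace (suc W) t (suc t) (B m)
    inNullSpace m = intercalate-inNullSpace (intercalateBasis m)

    independent : ∀ c → (∀ x → linComb (W ^ suc t) c B x ≡ 0ℚ) → ∀ m → c m ≡ 0ℚ
    independent c h m = begin
      c m                                              ≡⟨ cong c (encode-decode m) ⟨
      c (encode (decode m))                            ≡⟨ linComb-intercalateBasis c (decode m) ⟨
      linComb _ c B (Vec.map suc (decode m))           ≡⟨ h (Vec.map suc (decode m)) ⟩
      0ℚ                                               ∎
      where open ≡-Reasoning

    spanning : ∀ T → InNullSpace (suc W) t (suc t) T →
      Σ (Fin (W ^ suc t) → ℚ) (λ c → ∀ x → T x ≡ linComb (W ^ suc t) c B x)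
    spanning T hT = c , lineSumsVanish-unique (suc t) (inNullSpace⇒lineSumsVanish t hT)
      (lineSumsVanish-linComb _ c B (inNullSpace⇒lineSumsVanish t ∘ inNullSpace)) agree
      where
      c : Fin (W ^ suc t) → ℚ
      c m = T (Vec.map suc (decode m))
      agree : ∀ z → T (Vec.map suc z) ≡ linComb (W ^ suc t) c B (Vec.map suc z)
      agree z = sym (trans (linComb-intercalateBasis c z) (cong (T ∘ Vec.map suc) (decode-encode z)))

theorem3 : (v t : ℕ) → 2 ≤ v → 1 ≤ t →
    Σ ℕ (λ n → Σ (Fin n → Intercalate v (suc t)) (λ B →
      IsNullSpaceBasis v t (suc t) n (λ m → intercalateFreq (B m))))
theorem3 (suc W) t _ _ = W ^ suc t , intercalateBasis W t , intercalateBasis-isNullSpaceBasis W t
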